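{- For every partition $\mu$, $\mathrm{def}(\gamma_\mu)=|\mu|$.
   Context: Partitions are identified up to trailing zeros; $\ell(\gamma)$ is the number of nonzero parts, $|\gamma|$ the sum of parts; the diagram of $\gamma$ is $\{(i,j):1\leq i\leq\ell(\gamma),1\leq j\leq\gamma_i\}$. For a cell $c=(i,j)$, $\mathrm{arm}(c)=\gamma_i-j$, $\mathrm{leg}(c)=\gamma'_j-i$ ($\gamma'$ the conjugate). $\mathrm{dinv}(\gamma)$ is the number of cells with $\mathrm{arm}(c)-\mathrm{leg}(c)\in\{0,1\}$ and $\mathrm{def}(\gamma)=|\gamma|-\mathrm{dinv}(\gamma)$. For a sequence $v=(v_1,\ldots,v_n)$ (a Dyck vector: $v_1=0$, $v_i\geq0$, $v_{i+1}\leq v_i+1$), $\mathrm{dp}_n(v)=(n-1-v_n,n-2-v_{n-1},\ldots,1-v_2,0-v_1)$. For a nonzero partition $\mu$, let $\zeta(\mu)=\mu_1+\ell(\mu)$, let $e_j$ be the number of parts of $\mu$ equal to $j$, and set $\gamma_\mu=\mathrm{dp}_{\zeta(\mu)+1}(0,0,\underline{1}^{e_1},0,\underline{1}^{e_2},\ldots,0,\underline{1}^{e_{\mu_1}})$, where $\underline{1}^e$ denotes $e$ ones; for $\mu=(0)$, $\zeta(\mu)=0$ and $\gamma_\mu=(0)$. -}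

module Defs where

open import Data.Nat using (ℕ; zero; suc; _+_; _∸_; _≤_; _<_; _≥_; _≤?_; _≟_)
open import Data.Nat.ListAction using (sum)
open import Data.List using (List; []; _∷_; length; map; filter; upTo; reverse; zipWith; replicate; concat; _++_)
open import Data.List.Relation.Unary.All using (All)
open import Data.List.Relation.Unary.Linked using (Linked)
open import Data.Product using (_×_)
open import Relation.Nullary.Decidable using (⌊_⌋)
open import Data.Bool using (Bool; true; false; _∨_)

-- A partition: a weakly decreasing list of positive naturals
-- (canonical representative up to trailing zeros; the zero partition is []).
IsPartition : List ℕ → Set
IsPartition μ = Linked _≥_ μ × All (0 <_) μ

size : List ℕ → ℕ
size = sum

firstPart : List ℕ → ℕ
firstPart []      = 0
firstPart (x ∷ _) = x

ell : List ℕ → ℕ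
ell γ = length (filter (λ x → 1 ≤? x) γ)

conj : List ℕ → ℕ → ℕ
conj γ j = length (filter (λ x → j ≤? x) γ)

-- indicator that arm - leg ∈ {0,1}
good : ℕ → ℕ → ℕ
good a l with ⌊ a ≟ l ⌋ ∨ ⌊ a ≟ suc l ⌋
... | true  = 1
... | false = 0

-- contribution of row i (1-based) with part p: cells (i,j), 1 ≤ j ≤ p,
-- arm = p - j, leg = γ'_j - i
rowDinv : List ℕ → ℕ → ℕ → ℕ
rowDinv γ i p = sum (map (λ k → let j = suc k in good (p ∸ j) (conj γ j ∸ i)) (upTo p))

dinvRows : List ℕ → ℕ → List ℕ → ℕ
dinvRows γ i []       = 0
dinvRows γ i (p ∷ ps) = rowDinv γ i p + dinvRows γ (suc i) ps

dinv : List ℕ → ℕ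
dinv γ = dinvRows γ 1 γ

def : List ℕ → ℕ
def γ = size γ ∸ dinv γ

-- dp_n(v) = (n-1-v_n, n-2-v_{n-1}, …, 0-v_1)
dp : ℕ → List ℕ → List ℕ
dp n v = reverse (zipWith _∸_ (upTo n) v)

mult : List ℕ → ℕ → ℕ
mult μ j = length (filter (λ x → x ≟ j) μ)

ζ : List ℕ → ℕ
ζ μ = firstPart μ + ell μ

dyckVec : List ℕ → List ℕ
dyckVec μ = 0 ∷ concat (map (λ k → 0 ∷ replicate (mult μ (suc k)) 1) (upTo (firstPart μ)))

γ[_] : List ℕ → List ℕ
γ[ [] ]    = []
γ[ x ∷ μ ] = dp (suc (ζ (x ∷ μ))) (dyckVec (x ∷ μ))

module Submission where

-- γ_μ is dp of the binary Dyck vector 0 ∷ w with w = 0 1^{e₁} 0 1^{e₂} … 0 1^{e_{μ₁}},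
-- and dp of 0 ∷ w is the reversed "staircase" (0, 1 − w₁, 2 − w₂, …).  The heart
-- of the proof is the identity, valid for every binary w,
--     dinv (staircase w) + zeroOnePairs w = |staircase w|,                    (★)
-- where zeroOnePairs w counts the pairs k < l with w_k = 0 and w_l = 1.  It is
-- proved by induction on w, peeling off the first column of the diagram:
-- removing the first column of the staircase of b ∷ r leaves the staircase of r
-- plus a zero row, and a first-column cell in the row of r_k has arm − leg equal
-- to b − r_k, so it contributes to dinv unless b = 0 and r_k = 1;
-- those failures are exactly the pairs that b adds to zeroOnePairs.  Hence def γ_μ = |γ_μ| − dinv γ_μ = zeroOnePairs w = |μ|.

open import Defs
open import Data.Nat using (ℕ; zero; suc; _+_; _*_; _∸_; _≤_; _<_; z≤n; s≤s; pred; _<ᵇ_; _≤ᵇ_; _≡ᵇ_)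
open import Data.Nat.Properties
open import Data.Nat.ListAction using (sum)
open import Data.Nat.ListAction.Properties using (sum-++)
open import Data.List using (List; []; _∷_; [_]; length; map; upTo; applyUpTo; reverse; zipWith; replicate; concat; _++_)
open import Data.List.Properties using (map-cong; map-applyUpTo; map-upTo; map-id-local; unfold-reverse; reverse-map; length-++; length-reverse; length-replicate; length-applyUpTo; filter-all)
open import Data.List.Relation.Unary.All as All using (All; []; _∷_)
open import Data.List.Relation.Unary.All.Properties using (++⁺)
open import Data.List.Relation.Unary.Linked.Properties using (Linked⇒All)
open import Data.Product using (_×_; _,_; proj₁)
open import Data.Bool using (true; false; if_then_else_)
open import Data.Empty using (⊥-elim)
open import Function using (_∘_)
open import Relation.Nullary using (yes; no)
open import Relation.Binary.PropositionalEquality using (_≡_; refl; sym; trans; cong; cong₂)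
open import Algebra.Properties.CommutativeSemigroup +-commutativeSemigroup using (interchange; x∙yz≈y∙xz; xy∙z≈xz∙y)
open Relation.Binary.PropositionalEquality.≡-Reasoning

applyUpTo-cong : ∀ {A : Set} {f g : ℕ → A} → (∀ k → f k ≡ g k) → ∀ n → applyUpTo f n ≡ applyUpTo g n
applyUpTo-cong f≗g zero    = refl
applyUpTo-cong f≗g (suc n) = cong₂ _∷_ (f≗g 0) (applyUpTo-cong (f≗g ∘ suc) n)

good-refl : ∀ a → good a a ≡ 1
good-refl a with a ≟ a
... | yes _   = refl
... | no a≢a  = ⊥-elim (a≢a refl)

good-suc : ∀ a → good (suc a) a ≡ 1
good-suc a with suc a ≟ a | suc a ≟ suc a
... | yes _ | _      = refl
... | no _  | yes _  = refl
... | no _  | no ¬eq = ⊥-elim (¬eq refl)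

good-short : ∀ a → good a (suc a) ≡ 0
good-short a with a ≟ suc a | a ≟ suc (suc a)
... | yes eq | _      = ⊥-elim (1+n≢n (sym eq))
... | no _   | yes eq = ⊥-elim (m≢1+n+m a eq)
... | no _   | no _   = refl

conj-∷ : ∀ x xs j → conj (x ∷ xs) j ≡ conj [ x ] j + conj xs j
conj-∷ x xs j with j ≤ᵇ x
... | true  = refl
... | false = refl

conj-++ : ∀ xs ys j → conj (xs ++ ys) j ≡ conj xs j + conj ys j
conj-++ []       ys j = refl
conj-++ (x ∷ xs) ys j = begin
  conj (x ∷ xs ++ ys) j                  ≡⟨ conj-∷ x (xs ++ ys) j ⟩
  conj [ x ] j + conj (xs ++ ys) j       ≡⟨ cong (conj [ x ] j +_) (conj-++ xs ys j) ⟩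
  conj [ x ] j + (conj xs j + conj ys j) ≡⟨ +-assoc (conj [ x ] j) _ _ ⟨
  conj [ x ] j + conj xs j + conj ys j   ≡⟨ cong (_+ conj ys j) (conj-∷ x xs j) ⟨
  conj (x ∷ xs) j + conj ys j            ∎

conj-reverse : ∀ xs j → conj (reverse xs) j ≡ conj xs j
conj-reverse []       j = refl
conj-reverse (x ∷ xs) j = begin
  conj (reverse (x ∷ xs)) j        ≡⟨ cong (λ ys → conj ys j) (unfold-reverse x xs) ⟩
  conj (reverse xs ++ [ x ]) j     ≡⟨ conj-++ (reverse xs) [ x ] j ⟩
  conj (reverse xs) j + conj [ x ] j ≡⟨ cong (_+ conj [ x ] j) (conj-reverse xs j) ⟩
  conj xs j + conj [ x ] j         ≡⟨ +-comm (conj xs j) _ ⟩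
  conj [ x ] j + conj xs j         ≡⟨ conj-∷ x xs j ⟨
  conj (x ∷ xs) j                  ∎

-- Deleting the first column (decrementing every row) shifts the conjugate.
conj-pred : ∀ γ k → conj (map pred γ) (suc k) ≡ conj γ (suc (suc k))
conj-pred []           k = refl
conj-pred (zero ∷ γ)   k = conj-pred γ k
conj-pred (suc y ∷ γ)  k with k <ᵇ y
... | true  = cong suc (conj-pred γ k)
... | false = conj-pred γ k

-- First-column decomposition.  A row of length p has the cell (i,1) iff p > 0;
-- if the first column has length L, its arm is p − 1 and its leg is L − i.

firstCell : ℕ → ℕ → ℕ → ℕ
firstCell L i zero    = 0
firstCell L i (suc p) = good p (L ∸ i)

columnDinv : ℕ → ℕ → List ℕ → ℕ
columnDinv L i []       = 0
columnDinv L i (p ∷ ps) = firstCell L i p + columnDinv L (suc i) ps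

-- The cells (i, j+1) of γ are the cells (i, j) of map pred γ, with the same arm and leg.
rowDinv-firstColumn : ∀ γ i p →
  rowDinv γ i p ≡ firstCell (conj γ 1) i p + rowDinv (map pred γ) i (pred p)
rowDinv-firstColumn γ i zero    = refl
rowDinv-firstColumn γ i (suc p) = cong (firstCell (conj γ 1) i (suc p) +_) (begin
  sum (map cell (applyUpTo suc p))  ≡⟨ cong sum (map-applyUpTo suc cell p) ⟩
  sum (applyUpTo (cell ∘ suc) p)    ≡⟨ cong sum (applyUpTo-cong shifted p) ⟩
  sum (applyUpTo cell′ p)           ≡⟨ cong sum (map-upTo cell′ p) ⟨
  rowDinv (map pred γ) i p          ∎)
  where
    cell cell′ : ℕ → ℕ
    cell  k = good (suc p ∸ suc k) (conj γ (suc k) ∸ i)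
    cell′ k = good (p ∸ suc k) (conj (map pred γ) (suc k) ∸ i)
    shifted : ∀ k → cell (suc k) ≡ cell′ k
    shifted k = cong (λ c → good (p ∸ suc k) (c ∸ i)) (sym (conj-pred γ k))

dinvRows-firstColumn : ∀ γ i ps →
  dinvRows γ i ps ≡ columnDinv (conj γ 1) i ps + dinvRows (map pred γ) i (map pred ps)
dinvRows-firstColumn γ i []       = refl
dinvRows-firstColumn γ i (p ∷ ps) = trans
  (cong₂ _+_ (rowDinv-firstColumn γ i p) (dinvRows-firstColumn γ (suc i) ps))
  (interchange (firstCell (conj γ 1) i p) _ _ _)

dinv-firstColumn : ∀ γ → dinv γ ≡ columnDinv (conj γ 1) 1 γ + dinv (map pred γ)
dinv-firstColumn γ = dinvRows-firstColumn γ 1 γ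

size-firstColumn : ∀ γ → sum γ ≡ conj γ 1 + sum (map pred γ)
size-firstColumn []          = refl
size-firstColumn (zero ∷ γ)  = size-firstColumn γ
size-firstColumn (suc y ∷ γ) = cong suc (begin
  y + sum γ                             ≡⟨ cong (y +_) (size-firstColumn γ) ⟩
  y + (conj γ 1 + sum (map pred γ))     ≡⟨ x∙yz≈y∙xz y (conj γ 1) _ ⟩
  conj γ 1 + (y + sum (map pred γ))     ∎)

conj-∷ʳ0 : ∀ xs k → conj (xs ++ [ 0 ]) (suc k) ≡ conj xs (suc k)
conj-∷ʳ0 xs k = trans (conj-++ xs [ 0 ] (suc k)) (+-identityʳ _)

dinvRows-cong : ∀ γ δ i ps → (∀ k → conj γ (suc k) ≡ conj δ (suc k)) → dinvRows γ i ps ≡ dinvRows δ i ps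
dinvRows-cong γ δ i []       same = refl
dinvRows-cong γ δ i (p ∷ ps) same = cong₂ _+_
  (cong sum (map-cong (λ k → cong (λ c → good (p ∸ suc k) (c ∸ i)) (same k)) (upTo p)))
  (dinvRows-cong γ δ (suc i) ps same)

dinvRows-∷ʳ0 : ∀ γ i xs → dinvRows γ i (xs ++ [ 0 ]) ≡ dinvRows γ i xs
dinvRows-∷ʳ0 γ i []       = refl
dinvRows-∷ʳ0 γ i (x ∷ xs) = cong (rowDinv γ i x +_) (dinvRows-∷ʳ0 γ (suc i) xs)

dinv-∷ʳ0 : ∀ xs → dinv (xs ++ [ 0 ]) ≡ dinv xs
dinv-∷ʳ0 xs = trans (dinvRows-cong (xs ++ [ 0 ]) xs 1 (xs ++ [ 0 ]) (conj-∷ʳ0 xs)) (dinvRows-∷ʳ0 xs 1 xs)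

columnDinv-∷ʳ : ∀ L i xs y → columnDinv L i (xs ++ [ y ]) ≡ columnDinv L i xs + firstCell L (i + length xs) y
columnDinv-∷ʳ L i []       y = trans (+-identityʳ _) (cong (λ j → firstCell L j y) (sym (+-identityʳ i)))
columnDinv-∷ʳ L i (x ∷ xs) y = begin
  firstCell L i x + columnDinv L (suc i) (xs ++ [ y ])
    ≡⟨ cong (firstCell L i x +_) (columnDinv-∷ʳ L (suc i) xs y) ⟩
  firstCell L i x + (columnDinv L (suc i) xs + firstCell L (suc i + length xs) y)
    ≡⟨ +-assoc (firstCell L i x) _ _ ⟨
  firstCell L i x + columnDinv L (suc i) xs + firstCell L (suc i + length xs) y
    ≡⟨ cong (λ j → columnDinv L i (x ∷ xs) + firstCell L j y) (+-suc i (length xs)) ⟨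
  columnDinv L i (x ∷ xs) + firstCell L (i + length (x ∷ xs)) y ∎

-- Staircases.  stair i v = (i − v₁, i+1 − v₂, …), so dp n v = reverse (stair 0 v)
-- when n = length v; for a Dyck vector 0 ∷ w this is the staircase of w.

stair : ℕ → List ℕ → List ℕ
stair i []       = []
stair i (x ∷ xs) = (i ∸ x) ∷ stair (suc i) xs

staircase : List ℕ → List ℕ
staircase w = reverse (0 ∷ stair 1 w)

Binary : List ℕ → Set
Binary = All (_≤ 1)

zipWith-stair : ∀ (g : ℕ → ℕ) i v → (∀ k → g k ≡ i + k) → zipWith _∸_ (applyUpTo g (length v)) v ≡ stair i v
zipWith-stair g i []      g≗ = refl
zipWith-stair g i (x ∷ v) g≗ = cong₂ _∷_
  (cong (_∸ x) (trans (g≗ 0) (+-identityʳ i)))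
  (zipWith-stair (g ∘ suc) (suc i) v (λ k → trans (g≗ (suc k)) (+-suc i k)))

dp-staircase : ∀ w → dp (length (0 ∷ w)) (0 ∷ w) ≡ staircase w
dp-staircase w = cong reverse (zipWith-stair (λ k → k) 0 (0 ∷ w) (λ k → refl))

length-stair : ∀ i r → length (stair i r) ≡ length r
length-stair i []      = refl
length-stair i (x ∷ r) = cong suc (length-stair (suc i) r)

pred-stair : ∀ i r → map pred (stair (suc i) r) ≡ stair i r
pred-stair i []      = refl
pred-stair i (x ∷ r) = cong₂ _∷_ (pred[m∸n]≡m∸[1+n] (suc i) x) (pred-stair (suc i) r)

-- From offset 2 on, every row of a binary staircase is nonempty.
conj-stair : ∀ s r → Binary r → conj (stair (suc (suc s)) r) 1 ≡ length r
conj-stair s []            []             = refl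
conj-stair s (.0 ∷ r)      (z≤n ∷ hr)     = cong suc (conj-stair (suc s) r hr)
conj-stair s (.1 ∷ r)      (s≤s z≤n ∷ hr) = cong suc (conj-stair (suc s) r hr)

-- The first cell of the row 2+s − x (arm 1+s − x) with leg s + c is good
-- unless c = x = 1, when arm = s < leg = s+1.
firstCell-stair : ∀ s c x → c ≤ 1 → x ≤ 1 → ∀ L j → L ∸ j ≡ s + c →
  firstCell L j (suc (suc s) ∸ x) + c * x ≡ 1
firstCell-stair s .0 .0 z≤n z≤n L j leg
  rewrite leg | +-identityʳ s = trans (+-identityʳ _) (good-suc s)
firstCell-stair s .0 .1 z≤n (s≤s z≤n) L j leg
  rewrite leg | +-identityʳ s = trans (+-identityʳ _) (good-refl s)
firstCell-stair s .1 .0 (s≤s z≤n) z≤n L j leg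
  rewrite leg | +-comm s 1 = trans (+-identityʳ _) (good-refl (suc s))
firstCell-stair s .1 .1 (s≤s z≤n) (s≤s z≤n) L j leg
  rewrite leg | +-comm s 1 = cong (_+ 1) (good-short s)

-- The rows of the tail r of a staircase whose first column has length |r| + s + c
-- each contribute 1 to the column's dinv, except one per entry 1 of r when c = 1.
columnDinv-stair : ∀ r s c → c ≤ 1 → Binary r →
  columnDinv (length r + (s + c)) 1 (reverse (stair (suc (suc s)) r)) + c * sum r ≡ length r
columnDinv-stair []      s c c≤1 []         = *-zeroʳ c
columnDinv-stair (x ∷ r) s c c≤1 (x≤1 ∷ hr) = begin
  columnDinv L 1 (reverse (y ∷ rows)) + c * (x + sum r)
    ≡⟨ cong₂ (λ ys z → columnDinv L 1 ys + z) (unfold-reverse y rows) (cong (c *_) (+-comm x (sum r))) ⟩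
  columnDinv L 1 (reverse rows ++ [ y ]) + c * (sum r + x)
    ≡⟨ cong₂ _+_ (columnDinv-∷ʳ L 1 (reverse rows) y) (*-distribˡ-+ c (sum r) x) ⟩
  (columnDinv L 1 (reverse rows) + firstCell L (suc (length (reverse rows))) y) + (c * sum r + c * x)
    ≡⟨ interchange (columnDinv L 1 (reverse rows)) _ _ _ ⟩
  (columnDinv L 1 (reverse rows) + c * sum r) + (firstCell L (suc (length (reverse rows))) y + c * x)
    ≡⟨ cong₂ _+_ earlierRows (firstCell-stair s c x c≤1 x≤1 L _ leg) ⟩
  length r + 1
    ≡⟨ +-comm (length r) 1 ⟩
  suc (length r) ∎
  where
    L y : ℕ
    L = suc (length r + (s + c))
    y = suc (suc s) ∸ x
    rows : List ℕ
    rows = stair (suc (suc (suc s))) r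
    earlierRows : columnDinv L 1 (reverse rows) + c * sum r ≡ length r
    earlierRows = trans (cong (λ n → columnDinv n 1 (reverse rows) + c * sum r) (sym (+-suc (length r) (s + c))))
                        (columnDinv-stair r (suc s) c c≤1 hr)
    leg : L ∸ suc (length (reverse rows)) ≡ s + c
    leg = trans (cong (λ n → L ∸ suc n) (trans (length-reverse rows) (length-stair _ r)))
                (m+n∸m≡n (length r) (s + c))

zeroOnePairs : List ℕ → ℕ
zeroOnePairs []      = 0
zeroOnePairs (b ∷ r) = (1 ∸ b) * sum r + zeroOnePairs r

removeColumn : ∀ b r → map pred (staircase (b ∷ r)) ≡ staircase r ++ [ 0 ]
removeColumn b r = begin
  map pred (reverse (0 ∷ (1 ∸ b) ∷ stair 2 r))        ≡⟨ reverse-map pred (0 ∷ (1 ∸ b) ∷ stair 2 r) ⟩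
  reverse (0 ∷ pred (1 ∸ b) ∷ map pred (stair 2 r))   ≡⟨ cong (λ ys → reverse (0 ∷ ys)) (cong₂ _∷_ topRow (pred-stair 1 r)) ⟩
  reverse (0 ∷ 0 ∷ stair 1 r)                         ≡⟨ unfold-reverse 0 (0 ∷ stair 1 r) ⟩
  staircase r ++ [ 0 ]                                ∎
  where
    topRow : pred (1 ∸ b) ≡ 0
    topRow = trans (pred[m∸n]≡m∸[1+n] 1 b) (0∸n≡0 b)

columnLength : ∀ b r → b ≤ 1 → Binary r → conj (staircase (b ∷ r)) 1 ≡ length r + (1 ∸ b)
columnLength .0 r z≤n hr = begin
  conj (staircase (0 ∷ r)) 1  ≡⟨ conj-reverse (0 ∷ 1 ∷ stair 2 r) 1 ⟩
  suc (conj (stair 2 r) 1)    ≡⟨ cong suc (conj-stair 0 r hr) ⟩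
  suc (length r)              ≡⟨ +-comm 1 (length r) ⟩
  length r + 1                ∎
columnLength .1 r (s≤s z≤n) hr = begin
  conj (staircase (1 ∷ r)) 1  ≡⟨ conj-reverse (0 ∷ 0 ∷ stair 2 r) 1 ⟩
  conj (stair 2 r) 1          ≡⟨ conj-stair 0 r hr ⟩
  length r                    ≡⟨ +-identityʳ (length r) ⟨
  length r + 0                ∎

-- The row 1 − b, just below the rows of r, has a good first cell when it is nonempty
-- (arm 0, leg 0).
headCell : ∀ b n → b ≤ 1 → firstCell (n + (1 ∸ b)) (suc n) (1 ∸ b) ≡ 1 ∸ b
headCell .0 n z≤n = begin
  good 0 (n + 1 ∸ suc n)  ≡⟨ cong (λ m → good 0 (m ∸ suc n)) (+-comm n 1) ⟩
  good 0 (n ∸ n)          ≡⟨ cong (good 0) (n∸n≡0 n) ⟩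
  good 0 0                ≡⟨ good-refl 0 ⟩
  1                       ∎
headCell .1 n (s≤s z≤n) = refl

columnDinv-staircase : ∀ b r → b ≤ 1 → Binary r →
  columnDinv (length r + (1 ∸ b)) 1 (staircase (b ∷ r)) + (1 ∸ b) * sum r ≡ length r + (1 ∸ b)
columnDinv-staircase b r b≤1 hr = begin
  columnDinv L 1 (staircase (b ∷ r)) + c * sum r
    ≡⟨ cong (λ ys → columnDinv L 1 ys + c * sum r) rows ⟩
  columnDinv L 1 ((reverse X ++ [ c ]) ++ [ 0 ]) + c * sum r
    ≡⟨ cong (_+ c * sum r) (trans (columnDinv-∷ʳ L 1 (reverse X ++ [ c ]) 0) (+-identityʳ _)) ⟩
  columnDinv L 1 (reverse X ++ [ c ]) + c * sum r
    ≡⟨ cong (_+ c * sum r) (columnDinv-∷ʳ L 1 (reverse X) c) ⟩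
  columnDinv L 1 (reverse X) + firstCell L (suc (length (reverse X))) c + c * sum r
    ≡⟨ xy∙z≈xz∙y (columnDinv L 1 (reverse X)) _ _ ⟩
  columnDinv L 1 (reverse X) + c * sum r + firstCell L (suc (length (reverse X))) c
    ≡⟨ cong₂ _+_ (columnDinv-stair r 0 c (m∸n≤m 1 b) hr) topCell ⟩
  length r + c ∎
  where
    c L : ℕ
    c = 1 ∸ b
    L = length r + c
    X : List ℕ
    X = stair 2 r
    rows : staircase (b ∷ r) ≡ (reverse X ++ [ c ]) ++ [ 0 ]
    rows = trans (unfold-reverse 0 (c ∷ X)) (cong (_++ [ 0 ]) (unfold-reverse c X))
    topCell : firstCell L (suc (length (reverse X))) c ≡ c
    topCell = trans (cong (λ n → firstCell L (suc n) c) (trans (length-reverse X) (length-stair 2 r)))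
                    (headCell b (length r) b≤1)

dinv-staircase : ∀ w → Binary w → dinv (staircase w) + zeroOnePairs w ≡ sum (staircase w)
dinv-staircase []      []         = refl
dinv-staircase (b ∷ r) (b≤1 ∷ hr) = begin
  dinv γ + (c * sum r + zeroOnePairs r)
    ≡⟨ cong (_+ (c * sum r + zeroOnePairs r)) (dinv-firstColumn γ) ⟩
  columnDinv (conj γ 1) 1 γ + dinv (map pred γ) + (c * sum r + zeroOnePairs r)
    ≡⟨ cong₂ (λ L d → columnDinv L 1 γ + d + (c * sum r + zeroOnePairs r)) (columnLength b r b≤1 hr) dinvRest ⟩
  columnDinv L 1 γ + dinv (staircase r) + (c * sum r + zeroOnePairs r)
    ≡⟨ interchange (columnDinv L 1 γ) _ _ _ ⟩
  columnDinv L 1 γ + c * sum r + (dinv (staircase r) + zeroOnePairs r)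
    ≡⟨ cong₂ _+_ (columnDinv-staircase b r b≤1 hr) (dinv-staircase r hr) ⟩
  L + sum (staircase r)
    ≡⟨ cong₂ _+_ (columnLength b r b≤1 hr) sizeRest ⟨
  conj γ 1 + sum (map pred γ)
    ≡⟨ size-firstColumn γ ⟨
  sum γ ∎
  where
    γ : List ℕ
    γ = staircase (b ∷ r)
    c L : ℕ
    c = 1 ∸ b
    L = length r + c
    dinvRest : dinv (map pred γ) ≡ dinv (staircase r)
    dinvRest = trans (cong dinv (removeColumn b r)) (dinv-∷ʳ0 (staircase r))
    sizeRest : sum (map pred γ) ≡ sum (staircase r)
    sizeRest = trans (cong sum (removeColumn b r)) (trans (sum-++ (staircase r) [ 0 ]) (+-identityʳ _))

weighted : (ℕ → ℕ) → List ℕ → ℕ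
weighted w []       = 0
weighted w (x ∷ xs) = w 0 * x + weighted (w ∘ suc) xs

weighted-suc : ∀ w xs → weighted (suc ∘ w) xs ≡ sum xs + weighted w xs
weighted-suc w []       = refl
weighted-suc w (x ∷ xs) = begin
  (x + w 0 * x) + weighted (suc ∘ w ∘ suc) xs    ≡⟨ cong ((x + w 0 * x) +_) (weighted-suc (w ∘ suc) xs) ⟩
  (x + w 0 * x) + (sum xs + weighted (w ∘ suc) xs) ≡⟨ interchange x (w 0 * x) _ _ ⟩
  (x + sum xs) + (w 0 * x + weighted (w ∘ suc) xs) ∎

sum-weighted : ∀ xs → sum xs ≡ weighted (λ _ → 1) xs
sum-weighted []       = refl
sum-weighted (x ∷ xs) = cong₂ _+_ (sym (*-identityˡ x)) (sum-weighted xs)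

weighted-zeros : ∀ w n → weighted w (applyUpTo (λ _ → 0) n) ≡ 0
weighted-zeros w zero    = refl
weighted-zeros w (suc n) = cong₂ _+_ (*-zeroʳ (w 0)) (weighted-zeros (w ∘ suc) n)

weighted-+ : ∀ w (f g : ℕ → ℕ) n →
  weighted w (applyUpTo (λ k → f k + g k) n) ≡ weighted w (applyUpTo f n) + weighted w (applyUpTo g n)
weighted-+ w f g zero    = refl
weighted-+ w f g (suc n) = begin
  w 0 * (f 0 + g 0) + weighted (w ∘ suc) (applyUpTo (λ k → f (suc k) + g (suc k)) n)
    ≡⟨ cong₂ _+_ (*-distribˡ-+ (w 0) (f 0) (g 0)) (weighted-+ (w ∘ suc) (f ∘ suc) (g ∘ suc) n) ⟩
  (w 0 * f 0 + w 0 * g 0) + (weighted (w ∘ suc) (applyUpTo (f ∘ suc) n) + weighted (w ∘ suc) (applyUpTo (g ∘ suc) n))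
    ≡⟨ interchange (w 0 * f 0) _ _ _ ⟩
  weighted w (applyUpTo f (suc n)) + weighted w (applyUpTo g (suc n)) ∎

indicator : ℕ → ℕ → ℕ
indicator zero    zero    = 1
indicator zero    (suc k) = 0
indicator (suc t) zero    = 0
indicator (suc t) (suc k) = indicator t k

weighted-indicator : ∀ w n t → t < n → weighted w (applyUpTo (indicator t) n) ≡ w t
weighted-indicator w (suc n) zero    _ = begin
  w 0 * 1 + weighted (w ∘ suc) (applyUpTo (λ _ → 0) n)  ≡⟨ cong₂ _+_ (*-identityʳ (w 0)) (weighted-zeros (w ∘ suc) n) ⟩
  w 0 + 0                                              ≡⟨ +-identityʳ (w 0) ⟩
  w 0                                                  ∎
weighted-indicator w (suc n) (suc t) (s≤s t<n) =
  cong₂ _+_ (*-zeroʳ (w 0)) (weighted-indicator (w ∘ suc) n t t<n)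

indicator-≡ᵇ : ∀ x j → indicator x j ≡ (if x ≡ᵇ j then 1 else 0)
indicator-≡ᵇ zero    zero    = refl
indicator-≡ᵇ zero    (suc j) = refl
indicator-≡ᵇ (suc x) zero    = refl
indicator-≡ᵇ (suc x) (suc j) = indicator-≡ᵇ x j

mult-∷ : ∀ x μ j → mult (x ∷ μ) j ≡ indicator x j + mult μ j
mult-∷ x μ j rewrite indicator-≡ᵇ x j with x ≡ᵇ j
... | true  = refl
... | false = refl

multiplicities : ℕ → List ℕ → List ℕ
multiplicities m μ = applyUpTo (λ k → mult μ (suc k)) m

weighted-multiplicities : ∀ w m μ → All (λ x → 0 < x × x ≤ m) μ →
  weighted w (multiplicities m μ) ≡ sum (map (w ∘ pred) μ)
weighted-multiplicities w m []                 []                               = weighted-zeros w m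
weighted-multiplicities w m (.(suc t) ∷ μ) ((s≤s {n = t} z≤n , t<m) ∷ parts) = begin
  weighted w (multiplicities m (suc t ∷ μ))
    ≡⟨ cong (weighted w) (applyUpTo-cong (λ k → mult-∷ (suc t) μ (suc k)) m) ⟩
  weighted w (applyUpTo (λ k → indicator t k + mult μ (suc k)) m)
    ≡⟨ weighted-+ w (indicator t) (λ k → mult μ (suc k)) m ⟩
  weighted w (applyUpTo (indicator t) m) + weighted w (multiplicities m μ)
    ≡⟨ cong₂ _+_ (weighted-indicator w m t t<m) (weighted-multiplicities w m μ parts) ⟩
  w t + sum (map (w ∘ pred) μ) ∎

sum-multiplicities : ∀ m μ → All (λ x → 0 < x × x ≤ m) μ → sum (multiplicities m μ) ≡ length μ
sum-multiplicities m μ parts = begin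
  sum (multiplicities m μ)                    ≡⟨ sum-weighted (multiplicities m μ) ⟩
  weighted (λ _ → 1) (multiplicities m μ)     ≡⟨ weighted-multiplicities (λ _ → 1) m μ parts ⟩
  sum (map (λ _ → 1) μ)                       ≡⟨ count μ ⟩
  length μ                                    ∎
  where
    count : ∀ xs → sum (map (λ _ → 1) xs) ≡ length xs
    count []       = refl
    count (_ ∷ xs) = cong suc (count xs)

weighted-suc-multiplicities : ∀ m μ → All (λ x → 0 < x × x ≤ m) μ → weighted suc (multiplicities m μ) ≡ sum μ
weighted-suc-multiplicities m μ parts = begin
  weighted suc (multiplicities m μ) ≡⟨ weighted-multiplicities suc m μ parts ⟩
  sum (map (suc ∘ pred) μ)          ≡⟨ cong sum (map-id-local (All.map sucPred parts)) ⟩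
  sum μ                             ∎
  where
    sucPred : ∀ {x} → 0 < x × x ≤ m → suc (pred x) ≡ x
    sucPred (s≤s z≤n , _) = refl

block : ℕ → List ℕ
block e = 0 ∷ replicate e 1

blocks : List ℕ → List ℕ
blocks es = concat (map block es)

dyckVec-blocks : ∀ μ → dyckVec μ ≡ 0 ∷ blocks (multiplicities (firstPart μ) μ)
dyckVec-blocks μ = cong (λ bs → 0 ∷ concat bs)
  (trans (map-upTo (block ∘ e) (firstPart μ)) (sym (map-applyUpTo e block (firstPart μ))))
  where
    e : ℕ → ℕ
    e k = mult μ (suc k)

sum-ones : ∀ e → sum (replicate e 1) ≡ e
sum-ones zero    = refl
sum-ones (suc e) = cong suc (sum-ones e)

blocks-binary : ∀ es → Binary (blocks es)
blocks-binary []       = []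
blocks-binary (e ∷ es) = ++⁺ (z≤n ∷ ones e) (blocks-binary es)
  where
    ones : ∀ e → Binary (replicate e 1)
    ones zero    = []
    ones (suc e) = ≤-refl ∷ ones e

length-blocks : ∀ es → length (blocks es) ≡ length es + sum es
length-blocks []       = refl
length-blocks (e ∷ es) = begin
  length (block e ++ blocks es)                      ≡⟨ length-++ (block e) ⟩
  suc (length (replicate e 1) + length (blocks es))  ≡⟨ cong₂ (λ a b → suc (a + b)) (length-replicate e) (length-blocks es) ⟩
  suc (e + (length es + sum es))                     ≡⟨ cong suc (x∙yz≈y∙xz e (length es) (sum es)) ⟩
  suc (length es + (e + sum es))                     ∎

sum-blocks : ∀ es → sum (blocks es) ≡ sum es
sum-blocks []       = refl
sum-blocks (e ∷ es) = trans (sum-++ (block e) (blocks es)) (cong₂ _+_ (sum-ones e) (sum-blocks es))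

zeroOnePairs-ones : ∀ e ys → zeroOnePairs (replicate e 1 ++ ys) ≡ zeroOnePairs ys
zeroOnePairs-ones zero    ys = refl
zeroOnePairs-ones (suc e) ys = zeroOnePairs-ones e ys

-- Each 1 in the k-th block (from 1) is preceded by k zeros: the count is Σₖ k·e_k.
zeroOnePairs-blocks : ∀ es → zeroOnePairs (blocks es) ≡ weighted suc es
zeroOnePairs-blocks []       = refl
zeroOnePairs-blocks (e ∷ es) = begin
  1 * sum (replicate e 1 ++ blocks es) + zeroOnePairs (replicate e 1 ++ blocks es)
    ≡⟨ cong₂ _+_ (*-identityˡ _) (zeroOnePairs-ones e (blocks es)) ⟩
  sum (replicate e 1 ++ blocks es) + zeroOnePairs (blocks es)
    ≡⟨ cong₂ _+_ (trans (sum-++ (replicate e 1) (blocks es)) (cong₂ _+_ (sum-ones e) (sum-blocks es)))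
                 (zeroOnePairs-blocks es) ⟩
  e + sum es + weighted suc es
    ≡⟨ +-assoc e (sum es) _ ⟩
  e + (sum es + weighted suc es)
    ≡⟨ cong₂ _+_ (*-identityˡ e) (weighted-suc suc es) ⟨
  1 * e + weighted (suc ∘ suc) es ∎

partsBounded : ∀ m μ → IsPartition (m ∷ μ) → All (λ x → 0 < x × x ≤ m) (m ∷ μ)
partsBounded m μ (decreasing , positive) =
  All.zip (positive , Linked⇒All (λ x≥y y≥z → ≤-trans y≥z x≥y) ≤-refl decreasing)

-- γ_μ is the staircase of the blocks, the Dyck vector having length ζ(μ) + 1.
γ-staircase : ∀ m μ → All (λ x → 0 < x × x ≤ m) (m ∷ μ) →
  γ[ m ∷ μ ] ≡ staircase (blocks (multiplicities m (m ∷ μ)))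
γ-staircase m μ parts = begin
  dp (suc (ζ (m ∷ μ))) (dyckVec (m ∷ μ))  ≡⟨ cong₂ dp (cong suc (sym lengthBlocks)) (dyckVec-blocks (m ∷ μ)) ⟩
  dp (length (0 ∷ blocks es)) (0 ∷ blocks es)  ≡⟨ dp-staircase (blocks es) ⟩
  staircase (blocks es)  ∎
  where
    es : List ℕ
    es = multiplicities m (m ∷ μ)
    lengthBlocks : length (blocks es) ≡ ζ (m ∷ μ)
    lengthBlocks = begin
      length (blocks es)   ≡⟨ length-blocks es ⟩
      length es + sum es   ≡⟨ cong₂ _+_ (length-applyUpTo _ m) (sum-multiplicities m (m ∷ μ) parts) ⟩
      m + length (m ∷ μ)   ≡⟨ cong (λ xs → m + length xs) (filter-all (1 ≤?_) (All.map proj₁ parts)) ⟨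
      ζ (m ∷ μ)            ∎

lemma4p5 : (μ : List ℕ) → IsPartition μ → def γ[ μ ] ≡ size μ
lemma4p5 []      _         = refl
lemma4p5 (m ∷ μ) partition = begin
  sum γ[ m ∷ μ ] ∸ dinv γ[ m ∷ μ ]
    ≡⟨ cong (λ γ → sum γ ∸ dinv γ) (γ-staircase m μ parts) ⟩
  sum (staircase w) ∸ dinv (staircase w)
    ≡⟨ cong (_∸ dinv (staircase w)) (dinv-staircase w (blocks-binary es)) ⟨
  dinv (staircase w) + zeroOnePairs w ∸ dinv (staircase w)
    ≡⟨ m+n∸m≡n (dinv (staircase w)) (zeroOnePairs w) ⟩
  zeroOnePairs w
    ≡⟨ zeroOnePairs-blocks es ⟩
  weighted suc es
    ≡⟨ weighted-suc-multiplicities m (m ∷ μ) parts ⟩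
  sum (m ∷ μ) ∎
  where
    parts : All (λ x → 0 < x × x ≤ m) (m ∷ μ)
    parts = partsBounded m μ partition
    es w : List ℕ
    es = multiplicities m (m ∷ μ)
    w  = blocks es
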